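{- Let $m\ge 3$, let $\alpha$ be a primitive element of $\mathbb{F}_{2^m}$, and let $(\mathbb{F}_{2^m},\mathcal{B})$ be the Boolean $\mathrm{SQS}(2^m)$. Let $G$ be the group of affine maps $x\mapsto\alpha^k(x+t)$ ($k\in\mathbb{Z}_{2^m-1}$, $t\in\mathbb{F}_{2^m}$) acting on $\mathbb{F}_{2^m}$, and let $\mathcal{B}_h\subseteq\mathcal{B}$ be a single $G$-orbit of blocks such that $(\mathbb{F}_{2^m},\mathcal{B}_h)$ is a $2$-$(2^m,4,3)$ design. Take any block of the form $B=\{0,1,\alpha^j,\alpha^l\}\in\mathcal{B}_h$, where $\alpha^l=\alpha^j+1$, let $\widetilde{B}=\{0,1\mid\alpha^j,\alpha^l\}$, and define \[\mathscr{B}^{(j)}=\{\alpha^k\cdot(\widetilde{B}+t): k\in\mathbb{Z}_{2^m-1},\ t\in\mathbb{F}_{2^m}\},\] where $\alpha^k\cdot(\{x,y\mid z,w\}+t)=\{\alpha^k(x+t),\alpha^k(y+t)\mid\alpha^k(z+t),\alpha^k(w+t)\}$. Then $(\mathbb{F}_{2^m},\mathscr{B}^{(j)})$ is a completely uniform nested design of $(\mathbb{F}_{2^m},\mathcal{B}_h)$.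
   Context: The Boolean $\mathrm{SQS}(2^m)$ has point set $\mathbb{F}_{2^m}$ and block set $\mathcal{B}$ consisting of all $4$-sets $\{x,y,z,x+y+z\}$ with $x,y,z$ distinct. A $2$-$(v,4,\lambda)$ design is a pair $(V,\mathcal{C})$ with $|V|=v$ and $\mathcal{C}$ a set of $4$-subsets such that every $2$-subset lies in exactly $\lambda$ members of $\mathcal{C}$. A nested block $\{x,y\mid z,w\}$ denotes the unordered partition $\{\{x,y\},\{z,w\}\}$ of the $4$-set $\{x,y,z,w\}$ into two pairs. A nested design of a design $(V,\mathcal{C})$ with block size $4$ is a set $\mathscr{C}$ of nested blocks such that the map $\{x,y\mid z,w\}\mapsto\{x,y,z,w\}$ is a bijection from $\mathscr{C}$ onto $\mathcal{C}$ (each block is partitioned into two pairs exactly once). The multiplicity of a pair $\{x,y\}\in\binom{V}{2}$ is the number of nested blocks in $\mathscr{C}$ having $\{x,y\}$ as one of their two pairs; the nested design is completely uniform if every pair in $\binom{V}{2}$ has the same positive multiplicity. -}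

module Defs where

open import Level using (0ℓ)
open import Data.Nat as ℕ using (ℕ; zero; suc; _^_; _∸_)
open import Data.Fin using (Fin; toℕ)
open import Data.Fin.Properties using (any?; _≟_)
open import Data.Fin.Subset using (Subset; ⁅_⁆; _∪_; _∈_; ∣_∣)
open import Data.Fin.Subset.Properties using (_∈?_)
open import Data.Vec using (tabulate)
open import Data.Product using (Σ; ∃; ∃-syntax; _×_; _,_)
open import Data.Sum using (_⊎_)
open import Relation.Nullary using (¬_; does)
open import Relation.Nullary.Decidable using (_×-dec_)
open import Relation.Binary.PropositionalEquality using (_≡_; _≢_)
open import Algebra.Structures using (IsCommutativeRing)

Count : {A : Set} → (A → A → Set) → (A → Set) → ℕ → Set
Count {A} _~_ P n =
  Σ (Fin n → A) λ f →
    (∀ i → P (f i)) ×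
    (∀ i j → f i ~ f j → i ≡ j) ×
    (∀ a → P a → ∃[ i ] (a ~ f i))

-- A field of order 2^m, realised on the carrier Fin (2 ^ m)
-- (every field of order 2^m is isomorphic to one of these).

record GF (m : ℕ) : Set where
  infixl 6 _+_
  infixl 7 _*_
  field
    _+_ _*_ : Fin (2 ^ m) → Fin (2 ^ m) → Fin (2 ^ m)
    -_      : Fin (2 ^ m) → Fin (2 ^ m)
    0# 1#   : Fin (2 ^ m)
    isCommutativeRing : IsCommutativeRing _≡_ _+_ _*_ -_ 0# 1#
    0≢1     : 0# ≢ 1#
    inverse : ∀ x → x ≢ 0# → ∃[ y ] (x * y ≡ 1#)

  _^ᶠ_ : Fin (2 ^ m) → ℕ → Fin (2 ^ m)
  x ^ᶠ zero  = 1#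
  x ^ᶠ suc n = x * (x ^ᶠ n)

module _ {m : ℕ} (F : GF m) where
  open GF F

  private
    N = 2 ^ m
    Pt = Fin N

  Primitive : Pt → Set
  Primitive α = ∀ x → x ≢ 0# → ∃[ k ] (α ^ᶠ k ≡ x)

  pair : Pt → Pt → Subset N
  pair x y = ⁅ x ⁆ ∪ ⁅ y ⁆

  quad : Pt → Pt → Pt → Pt → Subset N
  quad x y z w = ⁅ x ⁆ ∪ ⁅ y ⁆ ∪ ⁅ z ⁆ ∪ ⁅ w ⁆

  image : (Pt → Pt) → Subset N → Subset N
  image f S = tabulate λ y → does (any? λ x → (x ∈? S) ×-dec (f x ≟ y))

  BooleanBlock : Subset N → Set
  BooleanBlock S = ∃[ x ] ∃[ y ] ∃[ z ]
    (x ≢ y × x ≢ z × y ≢ z × S ≡ quad x y z (x + y + z))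

  affine : Pt → Fin (N ∸ 1) → Pt → Pt → Pt
  affine α k t x = (α ^ᶠ toℕ k) * (x + t)

  Orbit : Pt → Subset N → Subset N → Set
  Orbit α B₀ S = ∃[ k ] ∃[ t ] (S ≡ image (affine α k t) B₀)

IsDesign : (v k λ′ : ℕ) → (Subset v → Set) → Set
IsDesign v k λ′ C =
  (∀ S → C S → ∣ S ∣ ≡ k) ×
  (∀ (x y : Fin v) → x ≢ y → Count _≡_ (λ S → C S × x ∈ S × y ∈ S) λ′)

-- Nested blocks {P | Q}: an unordered pair of 2-subsets.

NBlock : ℕ → Set
NBlock v = Subset v × Subset v

_≈ₙ_ : {v : ℕ} → NBlock v → NBlock v → Set
(P , Q) ≈ₙ (P′ , Q′) = (P ≡ P′ × Q ≡ Q′) ⊎ (P ≡ Q′ × Q ≡ P′)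

underlying : {v : ℕ} → NBlock v → Subset v
underlying (P , Q) = P ∪ Q

ValidNBlock : {v : ℕ} → NBlock v → Set
ValidNBlock {v} (P , Q) =
  ∣ P ∣ ≡ 2 × ∣ Q ∣ ≡ 2 × (∀ (x : Fin v) → x ∈ P → ¬ (x ∈ Q))

-- 𝒩 is a nested design of (Fin v, C): the map {P|Q} ↦ P ∪ Q is a
-- bijection from 𝒩 (a set of nested blocks, up to ≈ₙ) onto C.
IsNestedDesignOf : {v : ℕ} → (NBlock v → Set) → (Subset v → Set) → Set
IsNestedDesignOf 𝒩 C =
  (∀ b → 𝒩 b → ValidNBlock b × C (underlying b)) ×
  (∀ S → C S → ∃[ b ] (𝒩 b × underlying b ≡ S)) ×
  (∀ b b′ → 𝒩 b → 𝒩 b′ → underlying b ≡ underlying b′ → b ≈ₙ b′)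

HasPair : {v : ℕ} → NBlock v → Fin v → Fin v → Set
HasPair (P , Q) x y = P ≡ ⁅ x ⁆ ∪ ⁅ y ⁆ ⊎ Q ≡ ⁅ x ⁆ ∪ ⁅ y ⁆

Multiplicity : {v : ℕ} → (NBlock v → Set) → Fin v → Fin v → ℕ → Set
Multiplicity 𝒩 x y μ = Count _≈ₙ_ (λ b → 𝒩 b × HasPair b x y) μ

CompletelyUniform : {v : ℕ} → (NBlock v → Set) → Set
CompletelyUniform {v} 𝒩 =
  ∃[ μ ] (1 ℕ.≤ μ × (∀ (x y : Fin v) → x ≢ y → Multiplicity 𝒩 x y μ))

module _ {m : ℕ} (F : GF m) where
  open GF F

  NestedFamily : (α : Fin (2 ^ m)) → ℕ → ℕ → NBlock (2 ^ m) → Set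
  NestedFamily α j l b = ∃[ k ] ∃[ t ]
    (b ≈ₙ ( pair F (affine F α k t 0#) (affine F α k t 1#)
          , pair F (affine F α k t (α ^ᶠ j)) (affine F α k t (α ^ᶠ l))))

{-# OPTIONS --safe #-}
-- A field of order 2^m has characteristic 2, so B = {0, 1, a, a + 1} (a = α^j) is an
-- additive subgroup and the orbit blocks are the sets c (B + t), c ≠ 0.  Translating B
-- by one of its own elements permutes it but keeps the partition {0, 1 | a, a + 1}, so
-- the nesting of c (B + t) depends only on the block unless one block arises from two
-- different scales c.  That would put a² or (a + 1) a into B, which forces a² = a + 1;
-- then B is the subfield 𝔽₄, hence the only orbit block through 0 and 1, contradicting
-- λ = 3.  Both pairs of c (B̃ + t) sum to c, so a pair {x, y} lies only in nested blocks
-- with c = x + y, and these all agree up to translation by B.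
module Submission where

open import Defs
open import Level using (0ℓ)
open import Data.Empty using (⊥; ⊥-elim)
open import Data.Nat as ℕ using (ℕ; zero; suc; _≤_; _<_; _^_; _∸_; _<?_; s≤s; z≤n)
import Data.Nat.Properties as ℕ
open import Data.Nat.DivMod using (_%_; _/_; m%n<n; m≡m%n+[m/n]*n)
open import Data.Fin as Fin using (Fin; toℕ; fromℕ<; punchOut)
open import Data.Fin.Properties
  using (_≟_; any?; 0≢1+n; toℕ-injective; toℕ-fromℕ<; toℕ<n; punchOut-injective; pigeonhole)
open import Data.Fin.Permutation using (permutation)
open import Data.Fin.Subset using (Subset; ⁅_⁆; _∪_; _∈_; _⊆_; ∣_∣)
open import Data.Fin.Subset.Properties
  using ( x∈⁅x⁆; x∈⁅y⁆⇒x≡y; x∈p∪q⁻; x∈p∪q⁺; ⊆-antisym; p⊆q⇒∣p∣≤∣q∣; ∣⁅x⁆∣≡1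
        ; ∪-identityˡ; ∪-identityʳ; ∪-assoc; ∪-comm; _∈?_)
open import Data.Vec.Properties using ([]=⇒lookup; lookup⇒[]=; lookup∘tabulate)
open import Data.Product using (∃₂; ∃-syntax; _×_; _,_; proj₁; proj₂)
open import Data.Sum using (_⊎_; inj₁; inj₂)
open import Function using (_∘_)
open import Relation.Nullary using (Dec; yes; no)
open import Relation.Nullary.Decidable using (map′; dec-true; _×-dec_)
open import Relation.Binary.PropositionalEquality
  using (_≡_; _≢_; refl; sym; trans; cong; cong₂; subst; subst₂; module ≡-Reasoning)
open import Algebra.Structures using (IsCommutativeRing)
open import Algebra.Bundles using (CommutativeRing)
open import Algebra.Properties.CommutativeMonoid.Sum ℕ.+-0-commutativeMonoid
  using (sum; sum-cong-≗; sum-replicate-zero; ∑-distrib-+; sum-permute)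

open ≡-Reasoning

𝟙 : {P : Set} → Dec P → ℕ
𝟙 (yes _) = 1
𝟙 (no _)  = 0

𝟙-map′ : ∀ {P Q : Set} {f : P → Q} {g : Q → P} (P? : Dec P) → 𝟙 (map′ f g P?) ≡ 𝟙 P?
𝟙-map′ (yes _) = refl
𝟙-map′ (no _)  = refl

sum-const-1 : ∀ n → sum {n} (λ _ → 1) ≡ n
sum-const-1 zero    = refl
sum-const-1 (suc n) = cong suc (sum-const-1 n)

sum-𝟙-≟ : ∀ {n} (z : Fin n) → sum (λ i → 𝟙 (i ≟ z)) ≡ 1
sum-𝟙-≟ {suc n} Fin.zero    = cong suc (sum-replicate-zero n)
sum-𝟙-≟         (Fin.suc z) = trans (sum-cong-≗ (λ i → 𝟙-map′ (i ≟ z))) (sum-𝟙-≟ z)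

-- The points outside z split into the pairs {i, σ i}; each pair is
-- counted once by [i < σ i] and once by [σ i < i], and σ swaps the two counts.
involution-with-unique-fixpoint⇒odd :
  ∀ {n} (σ : Fin n → Fin n) → (∀ i → σ (σ i) ≡ i) →
  (z : Fin n) → σ z ≡ z → (∀ i → σ i ≡ i → i ≡ z) → ∃[ h ] n ≡ suc (2 ℕ.* h)
involution-with-unique-fixpoint⇒odd {n} σ σσ z σz≡z fixed⇒z = sum up , (begin
  n                                                         ≡⟨ sum-const-1 n ⟨
  sum {n} (λ _ → 1)                                         ≡⟨ sum-cong-≗ partition ⟨
  sum (λ i → up i ℕ.+ down i ℕ.+ 𝟙 (i ≟ z))                 ≡⟨ ∑-distrib-+ (λ i → up i ℕ.+ down i) _ ⟩
  sum (λ i → up i ℕ.+ down i) ℕ.+ sum (λ i → 𝟙 (i ≟ z))     ≡⟨ cong₂ ℕ._+_ (∑-distrib-+ up down) (sum-𝟙-≟ z) ⟩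
  sum up ℕ.+ sum down ℕ.+ 1                                 ≡⟨ cong (λ s → sum up ℕ.+ s ℕ.+ 1) down≡up ⟩
  sum up ℕ.+ sum up ℕ.+ 1                                   ≡⟨ double+1 (sum up) ⟩
  suc (2 ℕ.* sum up)                                        ∎)
  where
  up down : Fin n → ℕ
  up   i = 𝟙 (toℕ i <? toℕ (σ i))
  down i = 𝟙 (toℕ (σ i) <? toℕ i)

  partition : ∀ i → up i ℕ.+ down i ℕ.+ 𝟙 (i ≟ z) ≡ 1
  partition i with toℕ i <? toℕ (σ i) | toℕ (σ i) <? toℕ i | i ≟ z
  ... | yes i<σi | yes σi<i | _        = ⊥-elim (ℕ.<-asym i<σi σi<i)
  ... | yes i<σi | no _     | yes refl = ⊥-elim (ℕ.<-irrefl (cong toℕ (sym σz≡z)) i<σi)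
  ... | yes _    | no _     | no _     = refl
  ... | no _     | yes σi<i | yes refl = ⊥-elim (ℕ.<-irrefl (cong toℕ σz≡z) σi<i)
  ... | no _     | yes _    | no _     = refl
  ... | no _     | no _     | yes _    = refl
  ... | no i≮σi  | no σi≮i  | no i≢z   =
    ⊥-elim (i≢z (fixed⇒z i (toℕ-injective (ℕ.≤-antisym (ℕ.≮⇒≥ i≮σi) (ℕ.≮⇒≥ σi≮i)))))

  down≡up : sum down ≡ sum up
  down≡up = trans (sum-permute down (permutation σ σ σσ σσ))
                  (sum-cong-≗ λ i → cong (λ k → 𝟙 (toℕ k <? toℕ (σ i))) (σσ i))

  double+1 : ∀ h → h ℕ.+ h ℕ.+ 1 ≡ suc (2 ℕ.* h)
  double+1 h = trans (ℕ.+-comm (h ℕ.+ h) 1) (cong (λ k → suc (h ℕ.+ k)) (sym (ℕ.+-identityʳ h)))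

∣⁅x⁆∪⁅y⁆∣≡2 : ∀ {n} {x y : Fin n} → x ≢ y → ∣ ⁅ x ⁆ ∪ ⁅ y ⁆ ∣ ≡ 2
∣⁅x⁆∪⁅y⁆∣≡2 {x = Fin.zero}  {Fin.zero}  x≢y = ⊥-elim (x≢y refl)
∣⁅x⁆∪⁅y⁆∣≡2 {x = Fin.zero}  {Fin.suc y} _   = cong suc (trans (cong ∣_∣ (∪-identityˡ ⁅ y ⁆)) (∣⁅x⁆∣≡1 y))
∣⁅x⁆∪⁅y⁆∣≡2 {x = Fin.suc x} {Fin.zero}  _   = cong suc (trans (cong ∣_∣ (∪-identityʳ ⁅ x ⁆)) (∣⁅x⁆∣≡1 x))
∣⁅x⁆∪⁅y⁆∣≡2 {x = Fin.suc x} {Fin.suc y} x≢y = ∣⁅x⁆∪⁅y⁆∣≡2 (x≢y ∘ cong Fin.suc)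

pigeonhole-avoiding : ∀ {n} (f : ℕ → Fin n) (z : Fin n) → (∀ i → f i ≢ z) →
                      ∃₂ λ i j → i < j × j < n × f i ≡ f j
pigeonhole-avoiding {suc n} f z f≢z
  with i , j , i<j , eq ← pigeonhole (ℕ.n<1+n n) (λ i → punchOut (f≢z (toℕ i) ∘ sym))
  = toℕ i , toℕ j , i<j , toℕ<n j , punchOut-injective (f≢z (toℕ i) ∘ sym) (f≢z (toℕ j) ∘ sym) eq

module GFProperties {m : ℕ} (F : GF m) where
  open GF F public
  open IsCommutativeRing isCommutativeRing public
    using ( +-assoc; +-comm; +-identityˡ; +-identityʳ; -‿inverseʳ
          ; *-assoc; *-comm; *-identityˡ; *-identityʳ; distribˡ; distribʳ; zeroˡ; zeroʳ)

  Pt : Set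
  Pt = Fin (2 ^ m)

  commutativeRing : CommutativeRing 0ℓ 0ℓ
  commutativeRing = record { isCommutativeRing = isCommutativeRing }

  open import Algebra.Properties.Ring (CommutativeRing.ring commutativeRing) public
    using (-0#≈0#; -‿involutive)
  open import Algebra.Properties.CommutativeSemigroup
    (CommutativeRing.+-commutativeSemigroup commutativeRing) public
    renaming (interchange to +-interchange; x∙yz≈xz∙y to x+[y+z]≡[x+z]+y; x∙yz≈z∙yx to x+[y+z]≡z+[y+x])
    using ()

  *-cancelˡ : ∀ {c x y} → c ≢ 0# → c * x ≡ c * y → x ≡ y
  *-cancelˡ {c} {x} {y} c≢0 cx≡cy with c⁻¹ , cc⁻¹≡1 ← inverse c c≢0 = begin
    x                ≡⟨ *-identityˡ x ⟨
    1# * x           ≡⟨ cong (_* x) (trans (*-comm c⁻¹ c) cc⁻¹≡1) ⟨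
    (c⁻¹ * c) * x    ≡⟨ *-assoc c⁻¹ c x ⟩
    c⁻¹ * (c * x)    ≡⟨ cong (c⁻¹ *_) cx≡cy ⟩
    c⁻¹ * (c * y)    ≡⟨ *-assoc c⁻¹ c y ⟨
    (c⁻¹ * c) * y    ≡⟨ cong (_* y) (trans (*-comm c⁻¹ c) cc⁻¹≡1) ⟩
    1# * y           ≡⟨ *-identityˡ y ⟩
    y                ∎

  *-nonzero : ∀ {x y} → x ≢ 0# → y ≢ 0# → x * y ≢ 0#
  *-nonzero {x} x≢0 y≢0 xy≡0 = y≢0 (*-cancelˡ x≢0 (trans xy≡0 (sym (zeroʳ x))))

  *-inverse-unique : ∀ {c x y} → c * x ≡ 1# → x * y ≡ 1# → c ≡ y
  *-inverse-unique {c} {x} {y} cx≡1 xy≡1 = begin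
    c               ≡⟨ *-identityʳ c ⟨
    c * 1#          ≡⟨ cong (c *_) xy≡1 ⟨
    c * (x * y)     ≡⟨ *-assoc c x y ⟨
    (c * x) * y     ≡⟨ cong (_* y) cx≡1 ⟩
    1# * y          ≡⟨ *-identityˡ y ⟩
    y               ∎

  *≢0⇒≢0ʳ : ∀ {x y} → x * y ≢ 0# → y ≢ 0#
  *≢0⇒≢0ʳ {x} xy≢0 y≡0 = xy≢0 (trans (cong (x *_) y≡0) (zeroʳ x))

  x+[-x+y]≡y : ∀ x y → x + (- x + y) ≡ y
  x+[-x+y]≡y x y = trans (sym (+-assoc x (- x) y)) (trans (cong (_+ y) (-‿inverseʳ x)) (+-identityˡ y))

  nonzero-divides : ∀ {c} → c ≢ 0# → ∀ x → ∃[ y ] c * y ≡ x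
  nonzero-divides {c} c≢0 x with c⁻¹ , cc⁻¹≡1 ← inverse c c≢0 =
    c⁻¹ * x , trans (sym (*-assoc c c⁻¹ x)) (trans (cong (_* x) cc⁻¹≡1) (*-identityˡ x))

  -x≡x⇒x≡0 : 1# + 1# ≢ 0# → ∀ x → - x ≡ x → x ≡ 0#
  -x≡x⇒x≡0 2≢0 x -x≡x = *-cancelˡ 2≢0 (begin
    (1# + 1#) * x     ≡⟨ distribʳ x 1# 1# ⟩
    1# * x + 1# * x   ≡⟨ cong₂ _+_ (*-identityˡ x) (trans (*-identityˡ x) (sym -x≡x)) ⟩
    x + - x           ≡⟨ -‿inverseʳ x ⟩
    0#                ≡⟨ zeroʳ _ ⟨
    (1# + 1#) * 0#    ∎)

  -- If 1 + 1 ≠ 0 then x ↦ -x fixes only 0, which forces |F| = 2^m to be odd.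
  characteristic-2 : 1 ≤ m → 1# + 1# ≡ 0#
  characteristic-2 (s≤s {n = m′} _) with 1# + 1# ≟ 0#
  ... | yes 2≡0 = 2≡0
  ... | no  2≢0
    with h , 2^m≡2h+1 ← involution-with-unique-fixpoint⇒odd -_ -‿involutive 0# -0#≈0# (-x≡x⇒x≡0 2≢0)
    = ⊥-elim (ℕ.even≢odd (2 ^ m′) h 2^m≡2h+1)

  ^ᶠ-distribˡ-+-* : ∀ x i j → x ^ᶠ (i ℕ.+ j) ≡ x ^ᶠ i * x ^ᶠ j
  ^ᶠ-distribˡ-+-* x zero    j = sym (*-identityˡ _)
  ^ᶠ-distribˡ-+-* x (suc i) j = trans (cong (x *_) (^ᶠ-distribˡ-+-* x i j)) (sym (*-assoc x _ _))

  ^ᶠ-nonzero : ∀ {x} → x ≢ 0# → ∀ i → x ^ᶠ i ≢ 0#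
  ^ᶠ-nonzero x≢0 zero    = 0≢1 ∘ sym
  ^ᶠ-nonzero x≢0 (suc i) = *-nonzero x≢0 (^ᶠ-nonzero x≢0 i)

  ^ᶠ≢0,1⇒≢0 : ∀ {x} i → x ^ᶠ i ≢ 0# → x ^ᶠ i ≢ 1# → x ≢ 0#
  ^ᶠ≢0,1⇒≢0 zero    _      xⁱ≢1 _   = xⁱ≢1 refl
  ^ᶠ≢0,1⇒≢0 {x} (suc i) xⁱ≢0 _    x≡0 = xⁱ≢0 (trans (cong (_* x ^ᶠ i) x≡0) (zeroˡ _))

  ^ᶠ-*-period : ∀ {x} d → x ^ᶠ d ≡ 1# → ∀ q → x ^ᶠ (q ℕ.* d) ≡ 1#
  ^ᶠ-*-period d xᵈ≡1 zero    = refl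
  ^ᶠ-*-period {x} d xᵈ≡1 (suc q) = begin
    x ^ᶠ (d ℕ.+ q ℕ.* d)         ≡⟨ ^ᶠ-distribˡ-+-* x d (q ℕ.* d) ⟩
    x ^ᶠ d * x ^ᶠ (q ℕ.* d)      ≡⟨ cong₂ _*_ xᵈ≡1 (^ᶠ-*-period d xᵈ≡1 q) ⟩
    1# * 1#                      ≡⟨ *-identityˡ 1# ⟩
    1#                           ∎

  ^ᶠ-%-period : ∀ {x} d .{{_ : ℕ.NonZero d}} → x ^ᶠ d ≡ 1# → ∀ n → x ^ᶠ (n % d) ≡ x ^ᶠ n
  ^ᶠ-%-period {x} d xᵈ≡1 n = begin
    x ^ᶠ (n % d)                              ≡⟨ *-identityʳ _ ⟨
    x ^ᶠ (n % d) * 1#                         ≡⟨ cong (x ^ᶠ (n % d) *_) (^ᶠ-*-period d xᵈ≡1 (n / d)) ⟨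
    x ^ᶠ (n % d) * x ^ᶠ ((n / d) ℕ.* d)       ≡⟨ ^ᶠ-distribˡ-+-* x (n % d) _ ⟨
    x ^ᶠ (n % d ℕ.+ (n / d) ℕ.* d)            ≡⟨ cong (x ^ᶠ_) (m≡m%n+[m/n]*n n d) ⟨
    x ^ᶠ n                                    ∎

  module _ {α : Pt} (α≢0 : α ≢ 0#) where

    period : ∃[ d ] α ^ᶠ suc d ≡ 1# × suc d ≤ 2 ^ m ∸ 1
    period
      with i , j , i<j , j<2^m , αⁱ≡αʲ ← pigeonhole-avoiding (α ^ᶠ_) 0# (^ᶠ-nonzero α≢0)
      with d , refl ← ℕ.m≤n⇒∃[o]m+o≡n i<j
      = d
      , *-cancelˡ (^ᶠ-nonzero α≢0 i) (begin
          α ^ᶠ i * α ^ᶠ suc d   ≡⟨ ^ᶠ-distribˡ-+-* α i (suc d) ⟨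
          α ^ᶠ (i ℕ.+ suc d)    ≡⟨ cong (α ^ᶠ_) (ℕ.+-suc i d) ⟩
          α ^ᶠ suc (i ℕ.+ d)    ≡⟨ αⁱ≡αʲ ⟨
          α ^ᶠ i                ≡⟨ *-identityʳ _ ⟨
          α ^ᶠ i * 1#           ∎)
      , ℕ.≤-trans (s≤s (ℕ.m≤n+m d i))
          (subst (suc (i ℕ.+ d) ≤_) (ℕ.pred[m∸n]≡m∸[1+n] (2 ^ m) 0) (ℕ.<⇒≤pred j<2^m))

    primitive⇒exponent : Primitive F α → ∀ x → x ≢ 0# → ∃[ k ] α ^ᶠ toℕ {2 ^ m ∸ 1} k ≡ x
    primitive⇒exponent prim x x≢0
      with n , αⁿ≡x ← prim x x≢0
      with d , αᵈ≡1 , d<2^m ← period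
      with r<2^m-1 ← ℕ.<-≤-trans (m%n<n n (suc d)) d<2^m
      = fromℕ< r<2^m-1
      , trans (cong (α ^ᶠ_) (toℕ-fromℕ< r<2^m-1)) (trans (^ᶠ-%-period (suc d) αᵈ≡1 n) αⁿ≡x)

  aff : Pt → Pt → Pt → Pt
  aff c t x = c * (x + t)

  aff-∘ : ∀ c c′ t s x → aff c (c′ * s) (aff c′ t x) ≡ aff (c * c′) (t + s) x
  aff-∘ c c′ t s x = begin
    c * (c′ * (x + t) + c′ * s)   ≡⟨ cong (c *_) (distribˡ c′ (x + t) s) ⟨
    c * (c′ * ((x + t) + s))      ≡⟨ *-assoc c c′ _ ⟨
    (c * c′) * ((x + t) + s)      ≡⟨ cong ((c * c′) *_) (+-assoc x t s) ⟩
    (c * c′) * (x + (t + s))      ∎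

  module Characteristic2 (1+1≡0 : 1# + 1# ≡ 0#) where

    x+x≡0 : ∀ x → x + x ≡ 0#
    x+x≡0 x = begin
      x + x             ≡⟨ cong₂ _+_ (*-identityˡ x) (*-identityˡ x) ⟨
      1# * x + 1# * x   ≡⟨ distribʳ x 1# 1# ⟨
      (1# + 1#) * x     ≡⟨ cong (_* x) 1+1≡0 ⟩
      0# * x            ≡⟨ zeroˡ x ⟩
      0#                ∎

    x+[x+y]≡y : ∀ x y → x + (x + y) ≡ y
    x+[x+y]≡y x y = trans (sym (+-assoc x x y)) (trans (cong (_+ y) (x+x≡0 x)) (+-identityˡ y))

    [x+y]+y≡x : ∀ x y → (x + y) + y ≡ x
    [x+y]+y≡x x y = trans (+-assoc x y y) (trans (cong (x +_) (x+x≡0 y)) (+-identityʳ x))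

    x+y≡z⇒x≡z+y : ∀ {x y z} → x + y ≡ z → x ≡ z + y
    x+y≡z⇒x≡z+y {x} {y} x+y≡z = trans (sym ([x+y]+y≡x x y)) (cong (_+ y) x+y≡z)

    x+y≡0⇒x≡y : ∀ {x y} → x + y ≡ 0# → x ≡ y
    x+y≡0⇒x≡y {x} {y} x+y≡0 = trans (x+y≡z⇒x≡z+y x+y≡0) (+-identityˡ y)

    x≢y⇒x+y≢0 : ∀ {x y} → x ≢ y → x + y ≢ 0#
    x≢y⇒x+y≢0 x≢y = x≢y ∘ x+y≡0⇒x≡y

    aff-+ : ∀ c t x y → aff c t x + aff c t y ≡ c * (x + y)
    aff-+ c t x y = begin
      c * (x + t) + c * (y + t)    ≡⟨ distribˡ c _ _ ⟨
      c * ((x + t) + (y + t))      ≡⟨ cong (c *_) (+-interchange x t y t) ⟩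
      c * ((x + y) + (t + t))      ≡⟨ cong (λ s → c * ((x + y) + s)) (x+x≡0 t) ⟩
      c * ((x + y) + 0#)           ≡⟨ cong (c *_) (+-identityʳ _) ⟩
      c * (x + y)                  ∎

    aff-injective : ∀ {c t x y} → c ≢ 0# → aff c t x ≡ aff c t y → x ≡ y
    aff-injective {c} {t} {x} {y} c≢0 eq = begin
      x              ≡⟨ [x+y]+y≡x x t ⟨
      (x + t) + t    ≡⟨ cong (_+ t) (*-cancelˡ c≢0 eq) ⟩
      (y + t) + t    ≡⟨ [x+y]+y≡x y t ⟩
      y              ∎

module SubsetProperties {m : ℕ} (F : GF m) where
  open GFProperties F using (Pt)

  x∈pair : (x y : Pt) → x ∈ pair F x y
  x∈pair x y = x∈p∪q⁺ (inj₁ (x∈⁅x⁆ x))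

  y∈pair : (x y : Pt) → y ∈ pair F x y
  y∈pair x y = x∈p∪q⁺ (inj₂ (x∈⁅x⁆ y))

  ∈pair⁻ : ∀ {u} (x y : Pt) → u ∈ pair F x y → u ≡ x ⊎ u ≡ y
  ∈pair⁻ x y u∈ with x∈p∪q⁻ ⁅ x ⁆ ⁅ y ⁆ u∈
  ... | inj₁ u∈⁅x⁆ = inj₁ (x∈⁅y⁆⇒x≡y x u∈⁅x⁆)
  ... | inj₂ u∈⁅y⁆ = inj₂ (x∈⁅y⁆⇒x≡y y u∈⁅y⁆)

  pair-injective : ∀ {x y x′ y′ : Pt} → x ≢ y → pair F x′ y′ ≡ pair F x y →
                   (x′ ≡ x × y′ ≡ y) ⊎ (x′ ≡ y × y′ ≡ x)
  pair-injective {x} {y} {x′} {y′} x≢y eq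
    with ∈pair⁻ x′ y′ (subst (x ∈_) (sym eq) (x∈pair x y))
       | ∈pair⁻ x′ y′ (subst (y ∈_) (sym eq) (y∈pair x y))
  ... | inj₁ x≡x′ | inj₁ y≡x′ = ⊥-elim (x≢y (trans x≡x′ (sym y≡x′)))
  ... | inj₁ x≡x′ | inj₂ y≡y′ = inj₁ (sym x≡x′ , sym y≡y′)
  ... | inj₂ x≡y′ | inj₁ y≡x′ = inj₂ (sym y≡x′ , sym x≡y′)
  ... | inj₂ x≡y′ | inj₂ y≡y′ = ⊥-elim (x≢y (trans x≡y′ (sym y≡y′)))

  ∈quad⁻ : ∀ {u} (x y z w : Pt) → u ∈ quad F x y z w → u ≡ x ⊎ u ≡ y ⊎ u ≡ z ⊎ u ≡ w
  ∈quad⁻ x y z w u∈ with x∈p∪q⁻ ⁅ x ⁆ _ u∈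
  ... | inj₁ u∈⁅x⁆ = inj₁ (x∈⁅y⁆⇒x≡y x u∈⁅x⁆)
  ... | inj₂ u∈yzw with x∈p∪q⁻ ⁅ y ⁆ _ u∈yzw
  ...   | inj₁ u∈⁅y⁆ = inj₂ (inj₁ (x∈⁅y⁆⇒x≡y y u∈⁅y⁆))
  ...   | inj₂ u∈zw  = inj₂ (inj₂ (∈pair⁻ z w u∈zw))

  ∈quad⁺ : ∀ {u} (x y z w : Pt) → u ≡ x ⊎ u ≡ y ⊎ u ≡ z ⊎ u ≡ w → u ∈ quad F x y z w
  ∈quad⁺ x y z w (inj₁ refl)               = x∈p∪q⁺ (inj₁ (x∈⁅x⁆ x))
  ∈quad⁺ x y z w (inj₂ (inj₁ refl))        = x∈p∪q⁺ (inj₂ (x∈p∪q⁺ (inj₁ (x∈⁅x⁆ y))))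
  ∈quad⁺ x y z w (inj₂ (inj₂ (inj₁ refl))) = x∈p∪q⁺ (inj₂ (x∈p∪q⁺ (inj₂ (x∈pair z w))))
  ∈quad⁺ x y z w (inj₂ (inj₂ (inj₂ refl))) = x∈p∪q⁺ (inj₂ (x∈p∪q⁺ (inj₂ (y∈pair z w))))

  quad-⊆-pair : ∀ {x y z w : Pt} → z ∈ pair F x y → w ∈ pair F x y → quad F x y z w ⊆ pair F x y
  quad-⊆-pair {x} {y} {z} {w} z∈ w∈ u∈ with ∈quad⁻ x y z w u∈
  ... | inj₁ refl               = x∈pair x y
  ... | inj₂ (inj₁ refl)        = y∈pair x y
  ... | inj₂ (inj₂ (inj₁ refl)) = z∈
  ... | inj₂ (inj₂ (inj₂ refl)) = w∈

  module _ {f : Pt → Pt} where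

    ∈image⁻ : ∀ {S y} → y ∈ image F f S → ∃[ x ] (x ∈ S × f x ≡ y)
    ∈image⁻ {S} {y} y∈ with any? (λ x → (x ∈? S) ×-dec (f x ≟ y))
                          | trans (sym (lookup∘tabulate _ y)) ([]=⇒lookup y∈)
    ... | yes x∈S,fx≡y | _ = x∈S,fx≡y
    ... | no _         | ()

    ∈image⁺ : ∀ {S x y} → x ∈ S → f x ≡ y → y ∈ image F f S
    ∈image⁺ {S} {x} {y} x∈S fx≡y = lookup⇒[]= y _
      (trans (lookup∘tabulate _ y) (dec-true (any? λ x → (x ∈? S) ×-dec (f x ≟ y)) (x , x∈S , fx≡y)))

    image-∪ : ∀ p q → image F f (p ∪ q) ≡ image F f p ∪ image F f q
    image-∪ p q = ⊆-antisym into onto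
      where
      into : image F f (p ∪ q) ⊆ image F f p ∪ image F f q
      into y∈ with x , x∈p∪q , refl ← ∈image⁻ y∈ with x∈p∪q⁻ p q x∈p∪q
      ... | inj₁ x∈p = x∈p∪q⁺ (inj₁ (∈image⁺ x∈p refl))
      ... | inj₂ x∈q = x∈p∪q⁺ (inj₂ (∈image⁺ x∈q refl))
      onto : image F f p ∪ image F f q ⊆ image F f (p ∪ q)
      onto y∈ with x∈p∪q⁻ (image F f p) _ y∈
      ... | inj₁ y∈fp with x , x∈p , refl ← ∈image⁻ y∈fp = ∈image⁺ (x∈p∪q⁺ (inj₁ x∈p)) refl
      ... | inj₂ y∈fq with x , x∈q , refl ← ∈image⁻ y∈fq = ∈image⁺ (x∈p∪q⁺ (inj₂ x∈q)) refl

    image-⁅⁆ : ∀ x → image F f ⁅ x ⁆ ≡ ⁅ f x ⁆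
    image-⁅⁆ x = ⊆-antisym into onto
      where
      into : image F f ⁅ x ⁆ ⊆ ⁅ f x ⁆
      into y∈ with x′ , x′∈⁅x⁆ , refl ← ∈image⁻ y∈ rewrite x∈⁅y⁆⇒x≡y x x′∈⁅x⁆ = x∈⁅x⁆ (f x)
      onto : ⁅ f x ⁆ ⊆ image F f ⁅ x ⁆
      onto y∈ = ∈image⁺ (x∈⁅x⁆ x) (sym (x∈⁅y⁆⇒x≡y (f x) y∈))

    image-quad : ∀ x y z w → image F f (quad F x y z w) ≡ quad F (f x) (f y) (f z) (f w)
    image-quad x y z w =
      trans (image-∪ _ _) (cong₂ _∪_ (image-⁅⁆ x)
      (trans (image-∪ _ _) (cong₂ _∪_ (image-⁅⁆ y)
      (trans (image-∪ _ _) (cong₂ _∪_ (image-⁅⁆ z) (image-⁅⁆ w))))))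

  image-∘ : ∀ (f g : Pt → Pt) S → image F f (image F g S) ≡ image F (f ∘ g) S
  image-∘ f g S = ⊆-antisym into onto
    where
    into : image F f (image F g S) ⊆ image F (f ∘ g) S
    into y∈ with _ , u∈ , refl ← ∈image⁻ y∈ with _ , x∈S , refl ← ∈image⁻ u∈ = ∈image⁺ x∈S refl
    onto : image F (f ∘ g) S ⊆ image F f (image F g S)
    onto y∈ with _ , x∈S , refl ← ∈image⁻ y∈ = ∈image⁺ (∈image⁺ x∈S refl) refl

  image-cong : ∀ {f g : Pt → Pt} → (∀ x → f x ≡ g x) → ∀ S → image F f S ≡ image F g S
  image-cong {f} {g} f≗g S = ⊆-antisym into onto
    where
    into : image F f S ⊆ image F g S
    into y∈ with x , x∈S , refl ← ∈image⁻ y∈ = ∈image⁺ x∈S (sym (f≗g x))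
    onto : image F g S ⊆ image F f S
    onto y∈ with x , x∈S , refl ← ∈image⁻ y∈ = ∈image⁺ x∈S (f≗g x)

module _ {v : ℕ} where

  ≈ₙ-refl : ∀ {b : NBlock v} → b ≈ₙ b
  ≈ₙ-refl = inj₁ (refl , refl)

  ≈ₙ-sym : ∀ {b b′ : NBlock v} → b ≈ₙ b′ → b′ ≈ₙ b
  ≈ₙ-sym (inj₁ (P≡P′ , Q≡Q′)) = inj₁ (sym P≡P′ , sym Q≡Q′)
  ≈ₙ-sym (inj₂ (P≡Q′ , Q≡P′)) = inj₂ (sym Q≡P′ , sym P≡Q′)

  ≈ₙ-trans : ∀ {b b′ b″ : NBlock v} → b ≈ₙ b′ → b′ ≈ₙ b″ → b ≈ₙ b″
  ≈ₙ-trans (inj₁ (p , q)) (inj₁ (p′ , q′)) = inj₁ (trans p p′ , trans q q′)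
  ≈ₙ-trans (inj₁ (p , q)) (inj₂ (p′ , q′)) = inj₂ (trans p p′ , trans q q′)
  ≈ₙ-trans (inj₂ (p , q)) (inj₁ (p′ , q′)) = inj₂ (trans p q′ , trans q p′)
  ≈ₙ-trans (inj₂ (p , q)) (inj₂ (p′ , q′)) = inj₁ (trans p q′ , trans q p′)

  ≈ₙ⇒underlying≡ : ∀ {b b′ : NBlock v} → b ≈ₙ b′ → underlying b ≡ underlying b′
  ≈ₙ⇒underlying≡ (inj₁ (refl , refl)) = refl
  ≈ₙ⇒underlying≡ {P , Q} (inj₂ (refl , refl)) = ∪-comm P Q

  ≈ₙ-resp-Valid : ∀ {b b′ : NBlock v} → b ≈ₙ b′ → ValidNBlock b′ → ValidNBlock b
  ≈ₙ-resp-Valid (inj₁ (refl , refl)) valid = valid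
  ≈ₙ-resp-Valid (inj₂ (refl , refl)) (∣P∣≡2 , ∣Q∣≡2 , disjoint) =
    ∣Q∣≡2 , ∣P∣≡2 , λ x x∈Q x∈P → disjoint x x∈P x∈Q

  ≈ₙ-resp-HasPair : ∀ {b b′ : NBlock v} {x y} → b ≈ₙ b′ → HasPair b x y → HasPair b′ x y
  ≈ₙ-resp-HasPair (inj₁ (refl , refl)) has = has
  ≈ₙ-resp-HasPair (inj₂ (refl , refl)) (inj₁ P≡xy) = inj₂ P≡xy
  ≈ₙ-resp-HasPair (inj₂ (refl , refl)) (inj₂ Q≡xy) = inj₁ Q≡xy

module _ {m : ℕ} (F : GF m) where
  open GFProperties F
  open SubsetProperties F

  image-aff-∘ : ∀ c c₀ t₀ s S →
                image F (aff c (c₀ * s)) (image F (aff c₀ t₀) S) ≡ image F (aff (c * c₀) (t₀ + s)) S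
  image-aff-∘ c c₀ t₀ s S = trans (image-∘ _ _ S) (image-cong (aff-∘ c c₀ t₀ s) S)

  module AffineOrbit {α : Pt} (α≢0 : α ≢ 0#) (prim : Primitive F α) (B₀ : Subset (2 ^ m)) where

    Orbit-image : ∀ {S c} → Orbit F α B₀ S → c ≢ 0# → ∀ t → Orbit F α B₀ (image F (aff c t) S)
    Orbit-image {c = c} (k₀ , t₀ , refl) c≢0 t
      with s , c₀s≡t ← nonzero-divides (^ᶠ-nonzero α≢0 (toℕ k₀)) t
      with k , αᵏ≡cc₀ ← primitive⇒exponent α≢0 prim _ (*-nonzero c≢0 (^ᶠ-nonzero α≢0 (toℕ k₀)))
      = k , t₀ + s , (begin
        image F (aff c t) S₀                  ≡⟨ cong (λ t → image F (aff c t) S₀) c₀s≡t ⟨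
        image F (aff c (c₀ * s)) S₀           ≡⟨ image-aff-∘ c c₀ t₀ s B₀ ⟩
        image F (aff (c * c₀) (t₀ + s)) B₀    ≡⟨ cong (λ c → image F (aff c (t₀ + s)) B₀) αᵏ≡cc₀ ⟨
        image F (affine F α k (t₀ + s)) B₀    ∎)
      where
      c₀ : Pt
      c₀ = α ^ᶠ toℕ k₀

      S₀ : Subset (2 ^ m)
      S₀ = image F (aff c₀ t₀) B₀

    Orbit-related : ∀ {S S′} → Orbit F α B₀ S → Orbit F α B₀ S′ →
                    ∃[ k ] ∃[ t ] S′ ≡ image F (affine F α k t) S
    Orbit-related (k₀ , t₀ , refl) (k₁ , t₁ , refl)
      with c , c₀c≡c₁ ← nonzero-divides (^ᶠ-nonzero α≢0 (toℕ k₀)) (α ^ᶠ toℕ k₁)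
      with k , αᵏ≡c ← primitive⇒exponent α≢0 prim c
                        (*≢0⇒≢0ʳ (subst (_≢ 0#) (sym c₀c≡c₁) (^ᶠ-nonzero α≢0 (toℕ k₁))))
      = k , c₀ * s , (begin
        image F (aff (α ^ᶠ toℕ k₁) t₁) B₀     ≡⟨ image-cong (λ x → cong₂ (λ c t → aff c t x) c₁≡cc₀ t₁≡t₀+s) B₀ ⟩
        image F (aff (c * c₀) (t₀ + s)) B₀     ≡⟨ image-aff-∘ c c₀ t₀ s B₀ ⟨
        image F (aff c (c₀ * s)) S₀            ≡⟨ cong (λ c → image F (aff c (c₀ * s)) S₀) αᵏ≡c ⟨
        image F (affine F α k (c₀ * s)) S₀     ∎)
      where
      c₀ s : Pt
      c₀ = α ^ᶠ toℕ k₀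
      s  = - t₀ + t₁

      S₀ : Subset (2 ^ m)
      S₀ = image F (aff c₀ t₀) B₀

      c₁≡cc₀ : α ^ᶠ toℕ k₁ ≡ c * c₀
      c₁≡cc₀ = trans (sym c₀c≡c₁) (*-comm c₀ c)

      t₁≡t₀+s : t₁ ≡ t₀ + s
      t₁≡t₀+s = sym (x+[-x+y]≡y t₀ t₁)

  module NestedBlocks (1+1≡0 : 1# + 1# ≡ 0#)
                      (a b : Pt) (b≡a+1 : b ≡ a + 1#) (a≢0 : a ≢ 0#) (a≢1 : a ≢ 1#) where
    open Characteristic2 1+1≡0

    1+a≡b : 1# + a ≡ b
    1+a≡b = trans (+-comm 1# a) (sym b≡a+1)

    a+b≡1 : a + b ≡ 1#
    a+b≡1 = trans (cong (a +_) b≡a+1) (x+[x+y]≡y a 1#)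

    1+b≡a : 1# + b ≡ a
    1+b≡a = trans (+-comm 1# b) (trans (cong (_+ 1#) b≡a+1) ([x+y]+y≡x a 1#))

    b≢0 : b ≢ 0#
    b≢0 b≡0 = a≢1 (x+y≡0⇒x≡y (trans (sym b≡a+1) b≡0))

    b≢1 : b ≢ 1#
    b≢1 b≡1 = a≢0 (trans (sym 1+b≡a) (trans (cong (1# +_) b≡1) (x+x≡0 1#)))

    a≢b : a ≢ b
    a≢b a≡b = 0≢1 (trans (sym (x+x≡0 a)) (trans (cong (a +_) a≡b) a+b≡1))

    b*a≡a*a+a : b * a ≡ a * a + a
    b*a≡a*a+a = trans (cong (_* a) b≡a+1) (trans (distribʳ a a 1#) (cong (a * a +_) (*-identityˡ a)))

    b*b≡a*a+1 : b * b ≡ a * a + 1#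
    b*b≡a*a+1 = begin
      b * b              ≡⟨ cong (b *_) b≡a+1 ⟩
      b * (a + 1#)       ≡⟨ distribˡ b a 1# ⟩
      b * a + b * 1#     ≡⟨ cong₂ _+_ b*a≡a*a+a (*-identityʳ b) ⟩
      a * a + a + b      ≡⟨ +-assoc (a * a) a b ⟩
      a * a + (a + b)    ≡⟨ cong (a * a +_) a+b≡1 ⟩
      a * a + 1#         ∎

    -- V indexes the additive subgroup {0, 1, a, b} spanned by 1 and a; _⊕_ is its addition.
    data V : Set where
      0ᵥ 1ᵥ aᵥ bᵥ : V

    ⟦_⟧ : V → Pt
    ⟦ 0ᵥ ⟧ = 0#
    ⟦ 1ᵥ ⟧ = 1#
    ⟦ aᵥ ⟧ = a
    ⟦ bᵥ ⟧ = b

    infixl 6 _⊕_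
    _⊕_ : V → V → V
    0ᵥ ⊕ q  = q
    p  ⊕ 0ᵥ = p
    1ᵥ ⊕ 1ᵥ = 0ᵥ
    1ᵥ ⊕ aᵥ = bᵥ
    1ᵥ ⊕ bᵥ = aᵥ
    aᵥ ⊕ 1ᵥ = bᵥ
    aᵥ ⊕ aᵥ = 0ᵥ
    aᵥ ⊕ bᵥ = 1ᵥ
    bᵥ ⊕ 1ᵥ = aᵥ
    bᵥ ⊕ aᵥ = 1ᵥ
    bᵥ ⊕ bᵥ = 0ᵥ

    ⟦⊕⟧ : ∀ p q → ⟦ p ⊕ q ⟧ ≡ ⟦ p ⟧ + ⟦ q ⟧
    ⟦⊕⟧ 0ᵥ q  = sym (+-identityˡ ⟦ q ⟧)
    ⟦⊕⟧ 1ᵥ 0ᵥ = sym (+-identityʳ 1#)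
    ⟦⊕⟧ aᵥ 0ᵥ = sym (+-identityʳ a)
    ⟦⊕⟧ bᵥ 0ᵥ = sym (+-identityʳ b)
    ⟦⊕⟧ 1ᵥ 1ᵥ = sym (x+x≡0 1#)
    ⟦⊕⟧ 1ᵥ aᵥ = sym 1+a≡b
    ⟦⊕⟧ 1ᵥ bᵥ = sym 1+b≡a
    ⟦⊕⟧ aᵥ 1ᵥ = b≡a+1
    ⟦⊕⟧ aᵥ aᵥ = sym (x+x≡0 a)
    ⟦⊕⟧ aᵥ bᵥ = sym a+b≡1
    ⟦⊕⟧ bᵥ 1ᵥ = sym (trans (+-comm b 1#) 1+b≡a)
    ⟦⊕⟧ bᵥ aᵥ = sym (trans (+-comm b a) a+b≡1)
    ⟦⊕⟧ bᵥ bᵥ = sym (x+x≡0 b)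

    ⟦p⊕q⊕q⟧≡⟦p⟧ : ∀ p q → ⟦ p ⊕ q ⊕ q ⟧ ≡ ⟦ p ⟧
    ⟦p⊕q⊕q⟧≡⟦p⟧ p q = trans (⟦⊕⟧ (p ⊕ q) q) (trans (cong (_+ ⟦ q ⟧) (⟦⊕⟧ p q)) ([x+y]+y≡x ⟦ p ⟧ ⟦ q ⟧))

    B : Subset (2 ^ m)
    B = quad F 0# 1# a b

    ∈B⁻ : ∀ {u} → u ∈ B → ∃[ p ] u ≡ ⟦ p ⟧
    ∈B⁻ u∈B with ∈quad⁻ 0# 1# a b u∈B
    ... | inj₁ u≡0               = 0ᵥ , u≡0
    ... | inj₂ (inj₁ u≡1)        = 1ᵥ , u≡1
    ... | inj₂ (inj₂ (inj₁ u≡a)) = aᵥ , u≡a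
    ... | inj₂ (inj₂ (inj₂ u≡b)) = bᵥ , u≡b

    ∈B⁺ : ∀ p → ⟦ p ⟧ ∈ B
    ∈B⁺ 0ᵥ = ∈quad⁺ 0# 1# a b (inj₁ refl)
    ∈B⁺ 1ᵥ = ∈quad⁺ 0# 1# a b (inj₂ (inj₁ refl))
    ∈B⁺ aᵥ = ∈quad⁺ 0# 1# a b (inj₂ (inj₂ (inj₁ refl)))
    ∈B⁺ bᵥ = ∈quad⁺ 0# 1# a b (inj₂ (inj₂ (inj₂ refl)))

    -- c · (B̃ + t) with B̃ = {0, 1 | a, b}; for c = α^k this is the theorem's nested block.
    nested : Pt → Pt → NBlock (2 ^ m)
    nested c t = pair F (aff c t 0#) (aff c t 1#) , pair F (aff c t a) (aff c t b)

    block : Pt → Pt → Subset (2 ^ m)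
    block c t = image F (aff c t) B

    underlying-nested : ∀ c t → underlying (nested c t) ≡ block c t
    underlying-nested c t =
      trans (∪-assoc _ _ (pair F (aff c t a) (aff c t b))) (sym (image-quad 0# 1# a b))

    ∈block⁻ : ∀ {c t u} → u ∈ block c t → ∃[ p ] u ≡ aff c t ⟦ p ⟧
    ∈block⁻ u∈ with _ , x∈B , refl ← ∈image⁻ u∈ with p , refl ← ∈B⁻ x∈B = p , refl

    ∈block⁺ : ∀ {c t} p → aff c t ⟦ p ⟧ ∈ block c t
    ∈block⁺ p = ∈image⁺ (∈B⁺ p) refl

    aff-⊕ : ∀ c t p q → aff c t ⟦ p ⟧ + aff c t ⟦ q ⟧ ≡ c * ⟦ p ⊕ q ⟧
    aff-⊕ c t p q = trans (aff-+ c t ⟦ p ⟧ ⟦ q ⟧) (cong (c *_) (sym (⟦⊕⟧ p q)))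

    aff-centred : ∀ {c t} u → aff c t ⟦ u ⟧ ≡ 0# → ∀ p → aff c t ⟦ p ⟧ ≡ c * ⟦ p ⊕ u ⟧
    aff-centred {c} {t} u gu≡0 p = begin
      aff c t ⟦ p ⟧                    ≡⟨ +-identityʳ _ ⟨
      aff c t ⟦ p ⟧ + 0#               ≡⟨ cong (aff c t ⟦ p ⟧ +_) gu≡0 ⟨
      aff c t ⟦ p ⟧ + aff c t ⟦ u ⟧    ≡⟨ aff-⊕ c t p u ⟩
      c * ⟦ p ⊕ u ⟧                    ∎

    aff-translate : ∀ c t e p → aff c (t + ⟦ e ⟧) ⟦ p ⟧ ≡ aff c t ⟦ p ⊕ e ⟧
    aff-translate c t e p =
      cong (c *_) (trans (x+[y+z]≡[x+z]+y ⟦ p ⟧ t ⟦ e ⟧) (cong (_+ t) (sym (⟦⊕⟧ p e))))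

    translated-pair : ∀ c t e p q →
      pair F (aff c (t + ⟦ e ⟧) ⟦ p ⟧) (aff c (t + ⟦ e ⟧) ⟦ q ⟧) ≡ pair F (aff c t ⟦ p ⊕ e ⟧) (aff c t ⟦ q ⊕ e ⟧)
    translated-pair c t e p q = cong₂ (pair F) (aff-translate c t e p) (aff-translate c t e q)

    swapped-pair : ∀ c t e p q →
      pair F (aff c (t + ⟦ e ⟧) ⟦ p ⟧) (aff c (t + ⟦ e ⟧) ⟦ q ⟧) ≡ pair F (aff c t ⟦ q ⊕ e ⟧) (aff c t ⟦ p ⊕ e ⟧)
    swapped-pair c t e p q = trans (translated-pair c t e p q) (∪-comm _ _)

    nested-translate : ∀ c t e → nested c (t + ⟦ e ⟧) ≈ₙ nested c t
    nested-translate c t 0ᵥ = inj₁ (translated-pair c t 0ᵥ 0ᵥ 1ᵥ , translated-pair c t 0ᵥ aᵥ bᵥ)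
    nested-translate c t 1ᵥ = inj₁ (swapped-pair c t 1ᵥ 0ᵥ 1ᵥ , swapped-pair c t 1ᵥ aᵥ bᵥ)
    nested-translate c t aᵥ = inj₂ (translated-pair c t aᵥ 0ᵥ 1ᵥ , translated-pair c t aᵥ aᵥ bᵥ)
    nested-translate c t bᵥ = inj₂ (swapped-pair c t bᵥ 0ᵥ 1ᵥ , swapped-pair c t bᵥ aᵥ bᵥ)

    aff-≡⇒nested-≈ : ∀ {c t t′} p q → c ≢ 0# → aff c t ⟦ p ⟧ ≡ aff c t′ ⟦ q ⟧ → nested c t′ ≈ₙ nested c t
    aff-≡⇒nested-≈ {c} {t} {t′} p q c≢0 eq =
      subst (λ s → nested c s ≈ₙ nested c t) (sym t′≡t+⟦p⊕q⟧) (nested-translate c t (p ⊕ q))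
      where
      t′≡t+⟦p⊕q⟧ : t′ ≡ t + ⟦ p ⊕ q ⟧
      t′≡t+⟦p⊕q⟧ = begin
        t′                        ≡⟨ x+[x+y]≡y ⟦ q ⟧ t′ ⟨
        ⟦ q ⟧ + (⟦ q ⟧ + t′)      ≡⟨ cong (⟦ q ⟧ +_) (*-cancelˡ c≢0 eq) ⟨
        ⟦ q ⟧ + (⟦ p ⟧ + t)       ≡⟨ x+[y+z]≡z+[y+x] ⟦ q ⟧ ⟦ p ⟧ t ⟩
        t + (⟦ p ⟧ + ⟦ q ⟧)       ≡⟨ cong (t +_) (⟦⊕⟧ p q) ⟨
        t + ⟦ p ⊕ q ⟧             ∎

    nested-valid : ∀ {c t} → c ≢ 0# → ValidNBlock (nested c t)
    nested-valid {c} {t} c≢0 =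
      ∣⁅x⁆∪⁅y⁆∣≡2 (0≢1 ∘ aff-injective c≢0) , ∣⁅x⁆∪⁅y⁆∣≡2 (a≢b ∘ aff-injective c≢0) , disjoint
      where
      disjoint : ∀ x → x ∈ pair F (aff c t 0#) (aff c t 1#) → x ∈ pair F (aff c t a) (aff c t b) → ⊥
      disjoint x x∈P x∈Q with ∈pair⁻ _ _ x∈P | ∈pair⁻ _ _ x∈Q
      ... | inj₁ refl | inj₁ g0≡ga = a≢0 (sym (aff-injective c≢0 g0≡ga))
      ... | inj₁ refl | inj₂ g0≡gb = b≢0 (sym (aff-injective c≢0 g0≡gb))
      ... | inj₂ refl | inj₁ g1≡ga = a≢1 (sym (aff-injective c≢0 g1≡ga))
      ... | inj₂ refl | inj₂ g1≡gb = b≢1 (sym (aff-injective c≢0 g1≡gb))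

    aff-sum≡1 : ∀ c t {x y} → x + y ≡ 1# → c ≡ aff c t x + aff c t y
    aff-sum≡1 c t {x} {y} x+y≡1 = sym (trans (aff-+ c t x y) (trans (cong (c *_) x+y≡1) (*-identityʳ c)))

    pair-with-sum≡1 : ∀ {c t x y} p q → x ≢ y → ⟦ p ⟧ + ⟦ q ⟧ ≡ 1# →
      pair F (aff c t ⟦ p ⟧) (aff c t ⟦ q ⟧) ≡ pair F x y → c ≡ x + y × ∃[ r ] x ≡ aff c t ⟦ r ⟧
    pair-with-sum≡1 {c} {t} p q x≢y p+q≡1 eq with pair-injective x≢y eq
    ... | inj₁ (refl , refl) = aff-sum≡1 c t p+q≡1 , p , refl
    ... | inj₂ (refl , refl) = aff-sum≡1 c t (trans (+-comm ⟦ q ⟧ ⟦ p ⟧) p+q≡1) , q , refl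

    -- Both pairs {0, 1} and {a, b} have sum 1, so either pair of c · (B̃ + t) has sum c.
    nested-pair : ∀ {c t x y} → x ≢ y → HasPair (nested c t) x y → c ≡ x + y × ∃[ r ] x ≡ aff c t ⟦ r ⟧
    nested-pair x≢y (inj₁ P≡xy) = pair-with-sum≡1 0ᵥ 1ᵥ x≢y (+-identityˡ 1#) P≡xy
    nested-pair x≢y (inj₂ Q≡xy) = pair-with-sum≡1 aᵥ bᵥ x≢y a+b≡1 Q≡xy

    nested-sharing-pair-≈ : ∀ {c c′ t t′ x y} → x ≢ y → c ≢ 0# →
      HasPair (nested c t) x y → HasPair (nested c′ t′) x y → nested c t ≈ₙ nested c′ t′
    nested-sharing-pair-≈ x≢y c≢0 has has′
      with c≡x+y , r , x≡gr ← nested-pair x≢y has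
      with c′≡x+y , r′ , x≡g′r′ ← nested-pair x≢y has′
      with refl ← trans c′≡x+y (sym c≡x+y)
      = ≈ₙ-sym (aff-≡⇒nested-≈ r r′ c≢0 (trans (sym x≡gr) x≡g′r′))

    block-≡⇒aff-≡ : ∀ {c c′ t t′} → block c t ≡ block c′ t′ →
                    ∀ p → ∃[ q ] aff c t ⟦ p ⟧ ≡ aff c′ t′ ⟦ q ⟧
    block-≡⇒aff-≡ {c} {t = t} eq p = ∈block⁻ (subst (aff c t ⟦ p ⟧ ∈_) eq (∈block⁺ p))

    module _ (a*a≢b : a * a ≢ b) where

      a*a∉B : ∀ p → a * a ≢ ⟦ p ⟧
      a*a∉B 0ᵥ = *-nonzero a≢0 a≢0
      a*a∉B 1ᵥ a*a≡1 = *-nonzero b≢0 b≢0 (trans b*b≡a*a+1 (trans (cong (_+ 1#) a*a≡1) (x+x≡0 1#)))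
      a*a∉B aᵥ a*a≡a = a≢1 (*-cancelˡ a≢0 (trans a*a≡a (sym (*-identityʳ a))))
      a*a∉B bᵥ = a*a≢b

      b*a∉B : ∀ p → b * a ≢ ⟦ p ⟧
      b*a∉B 0ᵥ = *-nonzero b≢0 a≢0
      b*a∉B 1ᵥ b*a≡1 = a*a≢b (trans (x+y≡z⇒x≡z+y (trans (sym b*a≡a*a+a) b*a≡1)) 1+a≡b)
      b*a∉B aᵥ b*a≡a = b≢1 (*-cancelˡ a≢0 (trans (*-comm a b) (trans b*a≡a (sym (*-identityʳ a)))))
      b*a∉B bᵥ b*a≡b = a≢1 (*-cancelˡ b≢0 (trans b*a≡b (sym (*-identityʳ b))))

      -- Comparing the differences 1 - 0 and a - 0 inside the two blocks: if c = c′ d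
      -- with d ∈ {a, b}, then d a would lie in {0, 1, a, b}.
      block-≡⇒scale-≡ : ∀ {c c′ t t′} → c ≢ 0# → c′ ≢ 0# → block c t ≡ block c′ t′ → c ≡ c′
      block-≡⇒scale-≡ {c} {c′} {t} {t′} c≢0 c′≢0 eq
        with u , g0≡g′u ← block-≡⇒aff-≡ eq 0ᵥ
        with v , g1≡g′v ← block-≡⇒aff-≡ eq 1ᵥ
        with w , ga≡g′w ← block-≡⇒aff-≡ eq aᵥ
        = compare (u ⊕ v) (u ⊕ w) (differences 0ᵥ 1ᵥ u v g0≡g′u g1≡g′v)
                                        (differences 0ᵥ aᵥ u w g0≡g′u ga≡g′w)
        where
        differences : ∀ p q p′ q′ → aff c t ⟦ p ⟧ ≡ aff c′ t′ ⟦ p′ ⟧ → aff c t ⟦ q ⟧ ≡ aff c′ t′ ⟦ q′ ⟧ →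
                      c * ⟦ p ⊕ q ⟧ ≡ c′ * ⟦ p′ ⊕ q′ ⟧
        differences p q p′ q′ ep eq′ =
          trans (sym (aff-⊕ c t p q)) (trans (cong₂ _+_ ep eq′) (aff-⊕ c′ t′ p′ q′))

        ratio : ∀ {d x y} → c * 1# ≡ c′ * d → c * x ≡ c′ * y → d * x ≡ y
        ratio {d} {x} {y} c≡c′d cx≡c′y = *-cancelˡ c′≢0 (begin
          c′ * (d * x)    ≡⟨ *-assoc c′ d x ⟨
          (c′ * d) * x    ≡⟨ cong (_* x) c≡c′d ⟨
          (c * 1#) * x    ≡⟨ cong (_* x) (*-identityʳ c) ⟩
          c * x           ≡⟨ cx≡c′y ⟩
          c′ * y          ∎)

        compare : ∀ d e → c * 1# ≡ c′ * ⟦ d ⟧ → c * a ≡ c′ * ⟦ e ⟧ → c ≡ c′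
        compare 0ᵥ _ c≡0 _ = ⊥-elim (c≢0 (trans (sym (*-identityʳ c)) (trans c≡0 (zeroʳ c′))))
        compare 1ᵥ _ c≡c′ _ = trans (sym (*-identityʳ c)) (trans c≡c′ (*-identityʳ c′))
        compare aᵥ e c≡c′a ca≡c′e = ⊥-elim (a*a∉B e (ratio c≡c′a ca≡c′e))
        compare bᵥ e c≡c′b ca≡c′e = ⊥-elim (b*a∉B e (ratio c≡c′b ca≡c′e))

      block-≡⇒nested-≈ : ∀ {c c′ t t′} → c ≢ 0# → c′ ≢ 0# →
                         block c t ≡ block c′ t′ → nested c t ≈ₙ nested c′ t′
      block-≡⇒nested-≈ c≢0 c′≢0 eq
        with refl ← block-≡⇒scale-≡ c≢0 c′≢0 eq
        with u , g0≡g′u ← block-≡⇒aff-≡ eq 0ᵥ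
        = ≈ₙ-sym (aff-≡⇒nested-≈ 0ᵥ u c≢0 g0≡g′u)

    -- When a² = b the block {0, 1, a, b} is the subfield 𝔽₄, so it is the only
    -- affine image of itself through 0 and 1.
    module _ (a*a≡b : a * a ≡ b) where

      a*b≡1 : a * b ≡ 1#
      a*b≡1 = trans (*-comm a b) (trans b*a≡a*a+a (trans (cong (_+ a) a*a≡b) (trans (+-comm b a) a+b≡1)))

      b*b≡a : b * b ≡ a
      b*b≡a = trans b*b≡a*a+1 (trans (cong (_+ 1#) a*a≡b) (trans (+-comm b 1#) 1+b≡a))

      ⟦⟧-*-closed : ∀ p q → ∃[ r ] ⟦ p ⟧ * ⟦ q ⟧ ≡ ⟦ r ⟧
      ⟦⟧-*-closed 0ᵥ q  = 0ᵥ , zeroˡ ⟦ q ⟧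
      ⟦⟧-*-closed 1ᵥ q  = q , *-identityˡ ⟦ q ⟧
      ⟦⟧-*-closed p  0ᵥ = 0ᵥ , zeroʳ ⟦ p ⟧
      ⟦⟧-*-closed p  1ᵥ = p , *-identityʳ ⟦ p ⟧
      ⟦⟧-*-closed aᵥ aᵥ = bᵥ , a*a≡b
      ⟦⟧-*-closed aᵥ bᵥ = 1ᵥ , a*b≡1
      ⟦⟧-*-closed bᵥ aᵥ = 1ᵥ , trans (*-comm b a) a*b≡1
      ⟦⟧-*-closed bᵥ bᵥ = aᵥ , b*b≡a

      inverse-of-⟦⟧ : ∀ {c} p → c * ⟦ p ⟧ ≡ 1# → ∃[ q ] c ≡ ⟦ q ⟧
      inverse-of-⟦⟧ {c} 0ᵥ c*0≡1 = ⊥-elim (0≢1 (trans (sym (zeroʳ c)) c*0≡1))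
      inverse-of-⟦⟧ 1ᵥ c*1≡1 = 1ᵥ , *-inverse-unique c*1≡1 (*-identityʳ 1#)
      inverse-of-⟦⟧ aᵥ c*a≡1 = bᵥ , *-inverse-unique c*a≡1 a*b≡1
      inverse-of-⟦⟧ bᵥ c*b≡1 = aᵥ , *-inverse-unique c*b≡1 (trans (*-comm b a) a*b≡1)

      block∋0,1⇒≡B : ∀ {c t} → 0# ∈ block c t → 1# ∈ block c t → block c t ≡ B
      block∋0,1⇒≡B {c} {t} 0∈ 1∈
        with u , 0≡gu ← ∈block⁻ 0∈
        with v , 1≡gv ← ∈block⁻ 1∈
        = ⊆-antisym into onto
        where
        centred : ∀ p → aff c t ⟦ p ⟧ ≡ c * ⟦ p ⊕ u ⟧
        centred = aff-centred u (sym 0≡gu)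

        c⟦v⊕u⟧≡1 : c * ⟦ v ⊕ u ⟧ ≡ 1#
        c⟦v⊕u⟧≡1 = trans (sym (centred v)) (sym 1≡gv)

        into : block c t ⊆ B
        into x∈
          with p , refl ← ∈block⁻ x∈
          with d , c≡⟦d⟧ ← inverse-of-⟦⟧ (v ⊕ u) c⟦v⊕u⟧≡1
          with r , ⟦d⟧⟦p⊕u⟧≡⟦r⟧ ← ⟦⟧-*-closed d (p ⊕ u) =
          subst (_∈ B) (sym (trans (centred p) (trans (cong (_* ⟦ p ⊕ u ⟧) c≡⟦d⟧) ⟦d⟧⟦p⊕u⟧≡⟦r⟧))) (∈B⁺ r)

        onto : B ⊆ block c t
        onto x∈ with q , refl ← ∈B⁻ x∈ with r , ⟦v⊕u⟧⟦q⟧≡⟦r⟧ ← ⟦⟧-*-closed (v ⊕ u) q =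
          subst (_∈ block c t) (begin
            aff c t ⟦ r ⊕ u ⟧              ≡⟨ centred (r ⊕ u) ⟩
            c * ⟦ r ⊕ u ⊕ u ⟧              ≡⟨ cong (c *_) (⟦p⊕q⊕q⟧≡⟦p⟧ r u) ⟩
            c * ⟦ r ⟧                      ≡⟨ cong (c *_) ⟦v⊕u⟧⟦q⟧≡⟦r⟧ ⟨
            c * (⟦ v ⊕ u ⟧ * ⟦ q ⟧)        ≡⟨ *-assoc c _ _ ⟨
            (c * ⟦ v ⊕ u ⟧) * ⟦ q ⟧        ≡⟨ cong (_* ⟦ q ⟧) c⟦v⊕u⟧≡1 ⟩
            1# * ⟦ q ⟧                     ≡⟨ *-identityˡ ⟦ q ⟧ ⟩
            ⟦ q ⟧                          ∎) (∈block⁺ (r ⊕ u))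

  ∣quad∣≡4⇒∉𝔽₂ : 1# + 1# ≡ 0# → ∀ {a b} → b ≡ a + 1# → ∣ quad F 0# 1# a b ∣ ≡ 4 → a ≢ 0# × a ≢ 1#
  ∣quad∣≡4⇒∉𝔽₂ 1+1≡0 {a} {b} b≡a+1 ∣quad∣≡4 = a≢0 , a≢1
    where
    too-small : a ∈ pair F 0# 1# → b ∈ pair F 0# 1# → ⊥
    too-small a∈ b∈ with subst₂ _≤_ ∣quad∣≡4 (∣⁅x⁆∪⁅y⁆∣≡2 0≢1) (p⊆q⇒∣p∣≤∣q∣ (quad-⊆-pair a∈ b∈))
    ... | s≤s (s≤s ())

    a≢0 : a ≢ 0#
    a≢0 a≡0 = too-small (subst (_∈ pair F 0# 1#) (sym a≡0) (x∈pair 0# 1#))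
                        (subst (_∈ pair F 0# 1#) (sym b≡1) (y∈pair 0# 1#))
      where
      b≡1 : b ≡ 1#
      b≡1 = trans b≡a+1 (trans (cong (_+ 1#) a≡0) (+-identityˡ 1#))

    a≢1 : a ≢ 1#
    a≢1 a≡1 = too-small (subst (_∈ pair F 0# 1#) (sym a≡1) (y∈pair 0# 1#))
                        (subst (_∈ pair F 0# 1#) (sym b≡0) (x∈pair 0# 1#))
      where
      b≡0 : b ≡ 0#
      b≡0 = trans b≡a+1 (trans (cong (_+ 1#) a≡1) 1+1≡0)

  module NestedOrbitDesign (1+1≡0 : 1# + 1# ≡ 0#)
    {α : Pt} (α≢0 : α ≢ 0#) (prim : Primitive F α) (B₀ : Subset (2 ^ m))
    (j l : ℕ) (αˡ≡αʲ+1 : α ^ᶠ l ≡ α ^ᶠ j + 1#) (αʲ≢0 : α ^ᶠ j ≢ 0#) (αʲ≢1 : α ^ᶠ j ≢ 1#)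
    (B∈orbit : Orbit F α B₀ (quad F 0# 1# (α ^ᶠ j) (α ^ᶠ l))) where
    open Characteristic2 1+1≡0
    open NestedBlocks 1+1≡0 (α ^ᶠ j) (α ^ᶠ l) αˡ≡αʲ+1 αʲ≢0 αʲ≢1
    open AffineOrbit α≢0 prim B₀

    private
      𝒩 : NBlock (2 ^ m) → Set
      𝒩 = NestedFamily F α j l

      αᵏ≢0 : ∀ k → α ^ᶠ toℕ {2 ^ m ℕ.∸ 1} k ≢ 0#
      αᵏ≢0 k = ^ᶠ-nonzero α≢0 (toℕ k)

    orbit⇒block : ∀ {S} → Orbit F α B₀ S → ∃[ k ] ∃[ t ] S ≡ block (α ^ᶠ toℕ k) t
    orbit⇒block = Orbit-related B∈orbit

    family-valid : ∀ b → 𝒩 b → ValidNBlock b × Orbit F α B₀ (underlying b)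
    family-valid b (k , t , b≈) =
        ≈ₙ-resp-Valid b≈ (nested-valid (αᵏ≢0 k))
      , subst (Orbit F α B₀) (sym (trans (≈ₙ⇒underlying≡ b≈) (underlying-nested _ t)))
              (Orbit-image B∈orbit (αᵏ≢0 k) t)

    family-covers : ∀ S → Orbit F α B₀ S → ∃[ b ] (𝒩 b × underlying b ≡ S)
    family-covers S S∈orbit with k , t , refl ← orbit⇒block S∈orbit =
      nested (α ^ᶠ toℕ k) t , (k , t , ≈ₙ-refl) , underlying-nested _ t

    family-unique : α ^ᶠ j * α ^ᶠ j ≢ α ^ᶠ l →
      ∀ b b′ → 𝒩 b → 𝒩 b′ → underlying b ≡ underlying b′ → b ≈ₙ b′
    family-unique a*a≢b b b′ (k , t , b≈) (k′ , t′ , b′≈) eq =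
      ≈ₙ-trans b≈ (≈ₙ-trans (block-≡⇒nested-≈ a*a≢b (αᵏ≢0 k) (αᵏ≢0 k′) blocks≡) (≈ₙ-sym b′≈))
      where
      blocks≡ : block (α ^ᶠ toℕ k) t ≡ block (α ^ᶠ toℕ k′) t′
      blocks≡ = begin
        block (α ^ᶠ toℕ k) t      ≡⟨ trans (≈ₙ⇒underlying≡ b≈) (underlying-nested _ t) ⟨
        underlying b              ≡⟨ eq ⟩
        underlying b′             ≡⟨ trans (≈ₙ⇒underlying≡ b′≈) (underlying-nested _ t′) ⟩
        block (α ^ᶠ toℕ k′) t′    ∎

    multiplicity-one : ∀ x y → x ≢ y → Multiplicity 𝒩 x y 1
    multiplicity-one x y x≢y
      with t , [x+y]t≡x ← nonzero-divides (x≢y⇒x+y≢0 x≢y) x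
      with k , αᵏ≡x+y ← primitive⇒exponent α≢0 prim (x + y) (x≢y⇒x+y≢0 x≢y)
      = (λ _ → nested (α ^ᶠ toℕ k) t)
      , (λ _ → (k , t , ≈ₙ-refl) , has-xy)
      , (λ { Fin.zero Fin.zero _ → refl })
      , λ { b ((k′ , t′ , b≈) , has) →
            Fin.zero
          , ≈ₙ-trans b≈ (nested-sharing-pair-≈ x≢y (αᵏ≢0 k′) (≈ₙ-resp-HasPair b≈ has) has-xy) }
      where
      g0≡x : aff (α ^ᶠ toℕ k) t 0# ≡ x
      g0≡x = trans (cong₂ _*_ αᵏ≡x+y (+-identityˡ t)) [x+y]t≡x

      g1≡y : aff (α ^ᶠ toℕ k) t 1# ≡ y
      g1≡y = begin
        aff (α ^ᶠ toℕ k) t 1#          ≡⟨ cong (λ c → aff c t 1#) αᵏ≡x+y ⟩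
        (x + y) * (1# + t)             ≡⟨ distribˡ (x + y) 1# t ⟩
        (x + y) * 1# + (x + y) * t     ≡⟨ cong₂ _+_ (*-identityʳ (x + y)) [x+y]t≡x ⟩
        (x + y) + x                    ≡⟨ +-comm (x + y) x ⟩
        x + (x + y)                    ≡⟨ x+[x+y]≡y x y ⟩
        y                              ∎

      has-xy : HasPair (nested (α ^ᶠ toℕ k) t) x y
      has-xy = inj₁ (cong₂ (pair F) g0≡x g1≡y)

    orbit∋0,1⇒≡B : α ^ᶠ j * α ^ᶠ j ≡ α ^ᶠ l → ∀ {S} → Orbit F α B₀ S × 0# ∈ S × 1# ∈ S → S ≡ B
    orbit∋0,1⇒≡B a*a≡b (S∈orbit , 0∈S , 1∈S) with k , t , refl ← orbit⇒block S∈orbit =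
      block∋0,1⇒≡B a*a≡b 0∈S 1∈S

    two-blocks∋0,1⇒a*a≢b : ∀ {n} → Count _≡_ (λ S → Orbit F α B₀ S × 0# ∈ S × 1# ∈ S) (2 ℕ.+ n) →
                           α ^ᶠ j * α ^ᶠ j ≢ α ^ᶠ l
    two-blocks∋0,1⇒a*a≢b (f , f∈ , f-injective , _) a*a≡b =
      0≢1+n (f-injective Fin.zero (Fin.suc Fin.zero)
                         (trans (f≡B Fin.zero) (sym (f≡B (Fin.suc Fin.zero)))))
      where
      f≡B : ∀ i → f i ≡ B
      f≡B i = orbit∋0,1⇒≡B a*a≡b (f∈ i)

lemma4p6 : (m : ℕ) → 3 ≤ m → (F : GF m) → (α : Fin (2 ^ m)) → Primitive F α →
           (B₀ : Subset (2 ^ m)) → BooleanBlock F B₀ →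
           IsDesign (2 ^ m) 4 3 (Orbit F α B₀) →
           (j l : ℕ) → GF._^ᶠ_ F α l ≡ GF._+_ F (GF._^ᶠ_ F α j) (GF.1# F) →
           Orbit F α B₀ (quad F (GF.0# F) (GF.1# F) (GF._^ᶠ_ F α j) (GF._^ᶠ_ F α l)) →
           IsNestedDesignOf (NestedFamily F α j l) (Orbit F α B₀) ×
           CompletelyUniform (NestedFamily F α j l)
lemma4p6 m 3≤m F α prim B₀ _ (block-size , λ≡3) j l αˡ≡αʲ+1 B∈orbit =
    (family-valid , family-covers , family-unique (two-blocks∋0,1⇒a*a≢b (λ≡3 0# 1# 0≢1)))
  , (1 , s≤s z≤n , multiplicity-one)
  where
  open GFProperties F

  1+1≡0 : 1# + 1# ≡ 0#
  1+1≡0 = characteristic-2 (ℕ.≤-trans (s≤s z≤n) 3≤m)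

  αʲ∉𝔽₂ : α ^ᶠ j ≢ 0# × α ^ᶠ j ≢ 1#
  αʲ∉𝔽₂ = ∣quad∣≡4⇒∉𝔽₂ F 1+1≡0 αˡ≡αʲ+1 (block-size _ B∈orbit)

  open NestedOrbitDesign F 1+1≡0 (^ᶠ≢0,1⇒≢0 j (proj₁ αʲ∉𝔽₂) (proj₂ αʲ∉𝔽₂)) prim B₀ j l αˡ≡αʲ+1
                         (proj₁ αʲ∉𝔽₂) (proj₂ αʲ∉𝔽₂) B∈orbit
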